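{- (Lock Weakening) In the Fitch-style calculus for Intuitionistic R: if $\Gamma,\Gamma'\vdash t:A$ is derivable then $\Gamma,\bullet,\Gamma'\vdash t:A$ is derivable.
   Context: Types: $A,B ::= p \mid 1 \mid A\times B \mid A\to B \mid \Box A \mid \Diamond A$ ($p$ atoms). Contexts: $\Gamma ::= \cdot \mid \Gamma,x:A \mid \Gamma,\bullet$ (variables distinct; $\bullet$ is a structural symbol called a lock). Typing rules: (var) $\Gamma,x:A,\Gamma'\vdash x:A$ for any context $\Gamma'$; (products) $\Gamma\vdash\langle\rangle:1$; pairing and projections as usual; (functions) from $\Gamma,x:A\vdash t:B$ infer $\Gamma\vdash\lambda x.t:A\to B$; from $\Gamma\vdash t:A\to B$, $\Gamma\vdash u:A$ infer $\Gamma\vdash t\,u:B$; (shut) from $\Gamma,\bullet\vdash t:A$ infer $\Gamma\vdash\mathrm{shut}\,t:\Box A$; (open) from $\Gamma\vdash t:\Box A$ infer $\Gamma,\bullet,\Gamma'\vdash\mathrm{open}\,t:A$ for any context $\Gamma'$; (dia) from $\Gamma\vdash t:A$ infer $\Gamma,\bullet,\Gamma'\vdash\mathrm{dia}\,t:\Diamond A$ for any context $\Gamma'$; (let) from $\Gamma\vdash t:\Diamond A$ and $x:A,\bullet\vdash u:B$ infer $\Gamma\vdash\mathrm{let}\ \mathrm{dia}\,x=t\ \mathrm{in}\ u:B$. -}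

module Defs where

open import Data.Nat using (ℕ)
open import Relation.Binary.PropositionalEquality using (_≡_)
open import Relation.Nullary using (¬_)

Var : Set
Var = ℕ

data Ty : Set where
  atom : ℕ → Ty
  𝟙    : Ty
  _⊗_  : Ty → Ty → Ty
  _⇒_  : Ty → Ty → Ty
  □_   : Ty → Ty
  ◇_   : Ty → Ty

data Ctx : Set where
  ·     : Ctx
  _,_∶_ : Ctx → Var → Ty → Ctx
  _,•   : Ctx → Ctx

infixl 5 _,_∶_ _,•

_++_ : Ctx → Ctx → Ctx
Γ ++ ·          = Γ
Γ ++ (Δ , x ∶ A) = (Γ ++ Δ) , x ∶ A
Γ ++ (Δ ,•)      = (Γ ++ Δ) ,•

infixl 4 _++_

data _∈dom_ (x : Var) : Ctx → Set where
  here  : ∀ {Γ A} → x ∈dom (Γ , x ∶ A)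
  there : ∀ {Γ y A} → x ∈dom Γ → x ∈dom (Γ , y ∶ A)
  lock  : ∀ {Γ} → x ∈dom Γ → x ∈dom (Γ ,•)

data Tm : Set where
  var   : Var → Tm
  unit  : Tm
  pair  : Tm → Tm → Tm
  fst   : Tm → Tm
  snd   : Tm → Tm
  lam   : Var → Tm → Tm
  app   : Tm → Tm → Tm
  shut  : Tm → Tm
  open′ : Tm → Tm
  dia   : Tm → Tm
  letdia : Var → Tm → Tm → Tm

-- Typing judgement of the Fitch-style calculus for Intuitionistic R.
-- "Variables distinct" is enforced by: in (var) x does not occur in Γ',
-- and in (lam) the bound variable is fresh for Γ.
data _⊢_∶_ : Ctx → Tm → Ty → Set where
  ⊢var  : ∀ {Γ x A} Γ' → ¬ (x ∈dom Γ') → (Γ , x ∶ A ++ Γ') ⊢ var x ∶ A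
  ⊢unit : ∀ {Γ} → Γ ⊢ unit ∶ 𝟙
  ⊢pair : ∀ {Γ t u A B} → Γ ⊢ t ∶ A → Γ ⊢ u ∶ B → Γ ⊢ pair t u ∶ (A ⊗ B)
  ⊢fst  : ∀ {Γ t A B} → Γ ⊢ t ∶ (A ⊗ B) → Γ ⊢ fst t ∶ A
  ⊢snd  : ∀ {Γ t A B} → Γ ⊢ t ∶ (A ⊗ B) → Γ ⊢ snd t ∶ B
  ⊢lam  : ∀ {Γ x t A B} → ¬ (x ∈dom Γ) → (Γ , x ∶ A) ⊢ t ∶ B → Γ ⊢ lam x t ∶ (A ⇒ B)
  ⊢app  : ∀ {Γ t u A B} → Γ ⊢ t ∶ (A ⇒ B) → Γ ⊢ u ∶ A → Γ ⊢ app t u ∶ B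
  ⊢shut : ∀ {Γ t A} → (Γ ,•) ⊢ t ∶ A → Γ ⊢ shut t ∶ (□ A)
  ⊢open : ∀ {Γ t A} Γ' → Γ ⊢ t ∶ (□ A) → (Γ ,• ++ Γ') ⊢ open′ t ∶ A
  ⊢dia  : ∀ {Γ t A} Γ' → Γ ⊢ t ∶ A → (Γ ,• ++ Γ') ⊢ dia t ∶ (◇ A)
  ⊢let  : ∀ {Γ x t u A B} → Γ ⊢ t ∶ (◇ A) → (· , x ∶ A ,•) ⊢ u ∶ B
        → Γ ⊢ letdia x t u ∶ B

infix 3 _⊢_∶_

-- Generalise to inserting one lock at an arbitrary position and induct on the
-- derivation; the let body is typed in a closed context and is untouched.  The
-- only real work is in var, open and dia, whose conclusions end in an arbitrary
-- suffix Γ': a lock landing in that suffix, or exactly at its junction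
-- (Γ ,• ++ Γ' = Γ ++ (· ,• ++ Γ')), is absorbed by choosing a longer Γ', and a
-- lock landing in the prefix the rule inspects goes to the premise.
module Submission where

open import Defs
open import Relation.Binary.PropositionalEquality using (_≡_; refl; cong; subst)
open import Relation.Nullary using (¬_)

data InsertLock : Ctx → Ctx → Set where
  insert    : ∀ {Γ} → InsertLock Γ (Γ ,•)
  keep-var  : ∀ {Γ Δ x A} → InsertLock Γ Δ → InsertLock (Γ , x ∶ A) (Δ , x ∶ A)
  keep-lock : ∀ {Γ Δ} → InsertLock Γ Δ → InsertLock (Γ ,•) (Δ ,•)

∈dom-removeLock : ∀ {x Γ Δ} → InsertLock Γ Δ → x ∈dom Δ → x ∈dom Γ
∈dom-removeLock insert        (lock p)  = p
∈dom-removeLock (keep-var i)  here      = here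
∈dom-removeLock (keep-var i)  (there p) = there (∈dom-removeLock i p)
∈dom-removeLock (keep-lock i) (lock p)  = lock (∈dom-removeLock i p)

∉dom-insertLock : ∀ {x Γ Δ} → InsertLock Γ Δ → ¬ (x ∈dom Γ) → ¬ (x ∈dom Δ)
∉dom-insertLock i x∉Γ x∈Δ = x∉Γ (∈dom-removeLock i x∈Δ)

++-assoc : ∀ Γ Δ Θ → (Γ ++ (Δ ++ Θ)) ≡ ((Γ ++ Δ) ++ Θ)
++-assoc Γ Δ ·           = refl
++-assoc Γ Δ (Θ , x ∶ A) = cong (_, x ∶ A) (++-assoc Γ Δ Θ)
++-assoc Γ Δ (Θ ,•)      = cong _,• (++-assoc Γ Δ Θ)

insertLock-++ : ∀ Γ Γ' → InsertLock (Γ ++ Γ') (Γ ,• ++ Γ')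
insertLock-++ Γ ·            = insert
insertLock-++ Γ (Γ' , x ∶ A) = keep-var (insertLock-++ Γ Γ')
insertLock-++ Γ (Γ' ,•)      = keep-lock (insertLock-++ Γ Γ')

insertLock-front : ∀ Δ → InsertLock Δ (· ,• ++ Δ)
insertLock-front ·           = insert
insertLock-front (Δ , x ∶ A) = keep-var (insertLock-front Δ)
insertLock-front (Δ ,•)      = keep-lock (insertLock-front Δ)

data SplitInsertLock (Θ Θ' : Ctx) : Ctx → Set where
  inSuffix : ∀ {Θ''} → InsertLock Θ' Θ'' → SplitInsertLock Θ Θ' (Θ ++ Θ'')
  inPrefix : ∀ {Θ₂} → InsertLock Θ Θ₂ → SplitInsertLock Θ Θ' (Θ₂ ++ Θ')

-- A lock inserted exactly between Θ and Θ' (with Θ' nonempty) is reported as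
-- inPrefix insert.
splitInsertLock : ∀ Θ Θ' {Ξ} → InsertLock (Θ ++ Θ') Ξ → SplitInsertLock Θ Θ' Ξ
splitInsertLock Θ ·            i             = inPrefix i
splitInsertLock Θ (Θ' , y ∶ B) insert        = inSuffix insert
splitInsertLock Θ (Θ' , y ∶ B) (keep-var i)  with splitInsertLock Θ Θ' i
... | inSuffix j = inSuffix (keep-var j)
... | inPrefix j = inPrefix j
splitInsertLock Θ (Θ' ,•)      insert        = inSuffix insert
splitInsertLock Θ (Θ' ,•)      (keep-lock i) with splitInsertLock Θ Θ' i
... | inSuffix j = inSuffix (keep-lock j)
... | inPrefix j = inPrefix j

⊢-insertLock : ∀ {Θ Ξ t A} → Θ ⊢ t ∶ A → InsertLock Θ Ξ → Ξ ⊢ t ∶ A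
⊢-insertLock (⊢var {Δ} {x} {A} Δ' x∉Δ') i with splitInsertLock (Δ , x ∶ A) Δ' i
... | inSuffix j           = ⊢var _ (∉dom-insertLock j x∉Δ')
... | inPrefix (keep-var _) = ⊢var Δ' x∉Δ'
... | inPrefix insert      =
  subst (_⊢ var x ∶ A) (++-assoc (Δ , x ∶ A) (· ,•) Δ')
    (⊢var (· ,• ++ Δ') (∉dom-insertLock (insertLock-front Δ') x∉Δ'))
⊢-insertLock ⊢unit         i = ⊢unit
⊢-insertLock (⊢pair d e)  i = ⊢pair (⊢-insertLock d i) (⊢-insertLock e i)
⊢-insertLock (⊢fst d)     i = ⊢fst (⊢-insertLock d i)
⊢-insertLock (⊢snd d)     i = ⊢snd (⊢-insertLock d i)
⊢-insertLock (⊢lam x∉Θ d) i = ⊢lam (∉dom-insertLock i x∉Θ) (⊢-insertLock d (keep-var i))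
⊢-insertLock (⊢app d e)   i = ⊢app (⊢-insertLock d i) (⊢-insertLock e i)
⊢-insertLock (⊢shut d)    i = ⊢shut (⊢-insertLock d (keep-lock i))
⊢-insertLock (⊢open {Δ} {t} {A} Δ' d) i with splitInsertLock (Δ ,•) Δ' i
... | inSuffix _             = ⊢open _ d
... | inPrefix (keep-lock j) = ⊢open Δ' (⊢-insertLock d j)
... | inPrefix insert        = subst (_⊢ open′ t ∶ A) (++-assoc (Δ ,•) (· ,•) Δ') (⊢open (· ,• ++ Δ') d)
⊢-insertLock (⊢dia {Δ} {t} {A} Δ' d) i with splitInsertLock (Δ ,•) Δ' i
... | inSuffix _             = ⊢dia _ d
... | inPrefix (keep-lock j) = ⊢dia Δ' (⊢-insertLock d j)
... | inPrefix insert        = subst (_⊢ dia t ∶ ◇ A) (++-assoc (Δ ,•) (· ,•) Δ') (⊢dia (· ,• ++ Δ') d)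
⊢-insertLock (⊢let d e)   i = ⊢let (⊢-insertLock d i) e

lemma12 : (Γ Γ' : Ctx) (t : Tm) (A : Ty)
    → (Γ ++ Γ') ⊢ t ∶ A
    → (Γ ,• ++ Γ') ⊢ t ∶ A
lemma12 Γ Γ' t A d = ⊢-insertLock d (insertLock-++ Γ Γ')
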